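{- Let $G$ be a connected finite $\delta$-hyperbolic graph and let $\{x,y\}$ be a mutually distant pair of vertices. Every vertex $c$ satisfies $\max\{d(x,c),d(y,c)\}\le e(c)\le\max\{d(x,c),d(y,c)\}+2\delta$. Moreover, every vertex $c^*\in S_{\lfloor d(x,y)/2\rfloor}(x,y)\cup S_{\lfloor d(x,y)/2\rfloor}(y,x)$ has $e(c^*)\le\lceil d(x,y)/2\rceil+2\delta\le rad(G)+2\delta$. In particular, $diam(G)\ge d(x,y)\ge 2rad(G)-4\delta-1$.
   Context: $G$ is $\delta$-hyperbolic if for any four vertices $u,v,w,x$ the two larger of $d(u,v)+d(w,x)$, $d(u,w)+d(v,x)$, $d(u,x)+d(v,w)$ differ by at most $2\delta$ ($d$ = shortest-path distance). $e(v)=\max_u d(v,u)$, $F(v)=\{u: d(u,v)=e(v)\}$, $rad(G)=\min_v e(v)$, $diam(G)=\max_v e(v)$. $\{x,y\}$ is mutually distant if $x\in F(y)$ and $y\in F(x)$. $I(x,y)=\{z: d(x,z)+d(z,y)=d(x,y)\}$ and $S_k(x,y)=\{v\in I(x,y): d(v,x)=k\}$. -}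

module Defs where

open import Data.Nat using (ℕ; zero; suc; _+_; _*_; _≤_; _⊔_; _⊓_; ⌊_/2⌋; ⌈_/2⌉)
open import Data.Fin using (Fin)
open import Data.Vec using (Vec; tabulate; foldr; foldr₁)
open import Data.Product using (Σ; _×_)
open import Relation.Binary.PropositionalEquality using (_≡_)
open import Relation.Nullary using (¬_)

record Graph (n : ℕ) : Set₁ where
  field
    Adj       : Fin (suc n) → Fin (suc n) → Set
    Adj-sym   : ∀ {u v} → Adj u v → Adj v u
    Adj-irrefl : ∀ {u} → ¬ Adj u u

open Graph public

data Walk {n : ℕ} (G : Graph n) : Fin (suc n) → Fin (suc n) → ℕ → Set where
  nil  : ∀ {u} → Walk G u u 0
  cons : ∀ {u v w k} → Adj G u v → Walk G v w k → Walk G u w (suc k)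

Connected : ∀ {n} → Graph n → Set
Connected {n} G = ∀ (u v : Fin (suc n)) → Σ ℕ (λ k → Walk G u v k)

IsShortestPathDistance : ∀ {n} → Graph n → (Fin (suc n) → Fin (suc n) → ℕ) → Set
IsShortestPathDistance {n} G d =
  ∀ (u v : Fin (suc n)) → Walk G u v (d u v) × (∀ k → Walk G u v k → d u v ≤ k)

module _ {n : ℕ} (d : Fin (suc n) → Fin (suc n) → ℕ) where

  ecc : Fin (suc n) → ℕ
  ecc v = foldr _ _⊔_ 0 (tabulate (d v))

  rad : ℕ
  rad = foldr₁ _⊓_ (tabulate ecc)

  diam : ℕ
  diam = foldr _ _⊔_ 0 (tabulate ecc)

  -- δ-hyperbolicity, expressed with t = 2δ:
  -- the largest of the three sums exceeds the middle (second largest) by at most t.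
  largest : ℕ → ℕ → ℕ → ℕ
  largest a b c = a ⊔ b ⊔ c

  median : ℕ → ℕ → ℕ → ℕ
  median a b c = (a ⊓ b) ⊔ (b ⊓ c) ⊔ (a ⊓ c)

  HyperbolicWith2δ : ℕ → Set
  HyperbolicWith2δ t = ∀ (u v w x : Fin (suc n)) →
    let s₁ = d u v + d w x
        s₂ = d u w + d v x
        s₃ = d u x + d v w
    in largest s₁ s₂ s₃ ≤ median s₁ s₂ s₃ + t

  InFarthest : Fin (suc n) → Fin (suc n) → Set
  InFarthest u v = d u v ≡ ecc v

  MutuallyDistant : Fin (suc n) → Fin (suc n) → Set
  MutuallyDistant x y = InFarthest x y × InFarthest y x

  InInterval : Fin (suc n) → Fin (suc n) → Fin (suc n) → Set
  InInterval x y z = d x z + d z y ≡ d x y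

  InSlice : ℕ → Fin (suc n) → Fin (suc n) → Fin (suc n) → Set
  InSlice k x y v = InInterval x y v × d v x ≡ k

-- For a mutually distant pair {x, y}, both x and y lie at distance at most
-- d(x,y) from every vertex. Applying the four-point condition to c, v, x, y
-- therefore gives d(c,v) + d(x,y) ≤ max(d(c,x), d(c,y)) + d(x,y) + 2δ, which
-- is the upper bound on e(c). A vertex c* in the middle slice of a geodesic
-- from x to y is within ⌈d(x,y)/2⌉ of both ends, while every vertex is at
-- distance at least ⌈d(x,y)/2⌉ from one of them by the triangle inequality;
-- this sandwiches rad(G) and yields the remaining inequalities.
module Submission where

open import Defs
open import Data.Nat using (ℕ; zero; suc; _+_; _*_; _∸_; _≤_; _⊔_; _⊓_; ⌊_/2⌋; ⌈_/2⌉; z≤n)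
open import Data.Nat.Properties
open import Data.Fin using (Fin; zero; suc)
open import Data.Product using (Σ; ∃; _×_; _,_; proj₁; proj₂)
open import Data.Sum using (_⊎_; inj₁; inj₂)
open import Data.Vec using (tabulate; foldr; foldr₁)
open import Function using (_∘_)
open import Relation.Binary.PropositionalEquality
  using (_≡_; refl; sym; trans; cong; cong₂; subst)

module Walks {n : ℕ} (G : Graph n) where

  _++ʷ_ : ∀ {u v w k m} → Walk G u v k → Walk G v w m → Walk G u w (k + m)
  nil      ++ʷ q = q
  cons a p ++ʷ q = cons a (p ++ʷ q)

  reverseAcc : ∀ {u v w k m} → Walk G u v k → Walk G u w m → Walk G v w (k + m)
  reverseAcc nil acc = acc
  reverseAcc {k = suc k} {m} (cons a p) acc =
    subst (Walk G _ _) (+-suc k m) (reverseAcc p (cons (Adj-sym G a) acc))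

  reverse : ∀ {u v k} → Walk G u v k → Walk G v u k
  reverse {k = k} p = subst (Walk G _ _) (+-identityʳ k) (reverseAcc p nil)

  splitAt : ∀ {u v} k {m} → Walk G u v (k + m) →
            Σ (Fin (suc n)) λ w → Walk G u w k × Walk G w v m
  splitAt zero    p          = _ , nil , p
  splitAt (suc k) (cons a p) with splitAt k p
  ... | w , p₁ , p₂ = w , cons a p₁ , p₂

≤-max-tabulate : ∀ {m} (f : Fin m → ℕ) i → f i ≤ foldr _ _⊔_ 0 (tabulate f)
≤-max-tabulate f zero    = m≤m⊔n _ _
≤-max-tabulate f (suc i) = ≤-trans (≤-max-tabulate (f ∘ suc) i) (m≤n⊔m (f zero) _)

max-tabulate-lub : ∀ {m b} (f : Fin m → ℕ) → (∀ i → f i ≤ b) → foldr _ _⊔_ 0 (tabulate f) ≤ b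
max-tabulate-lub {zero}  f f≤b = z≤n
max-tabulate-lub {suc m} f f≤b = ⊔-lub (f≤b zero) (max-tabulate-lub (f ∘ suc) (f≤b ∘ suc))

min-tabulate-≤ : ∀ {m} (f : Fin (suc m) → ℕ) i → foldr₁ _⊓_ (tabulate f) ≤ f i
min-tabulate-≤ {zero}  f zero    = ≤-refl
min-tabulate-≤ {suc m} f zero    = m⊓n≤m _ _
min-tabulate-≤ {suc m} f (suc i) = ≤-trans (m⊓n≤n (f zero) _) (min-tabulate-≤ (f ∘ suc) i)

min-tabulate-glb : ∀ {m b} (f : Fin (suc m) → ℕ) → (∀ i → b ≤ f i) → b ≤ foldr₁ _⊓_ (tabulate f)
min-tabulate-glb {zero}  f b≤f = b≤f zero
min-tabulate-glb {suc m} f b≤f = ⊓-glb (b≤f zero) (min-tabulate-glb (f ∘ suc) (b≤f ∘ suc))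

⌈/2⌉≤⊔ : ∀ {D} a b → D ≤ a + b → ⌈ D /2⌉ ≤ a ⊔ b
⌈/2⌉≤⊔ a b D≤a+b = begin
  ⌈ _ /2⌉               ≤⟨ ⌈n/2⌉-mono (≤-trans D≤a+b (+-mono-≤ (m≤m⊔n a b) (m≤n⊔m a b))) ⟩
  ⌈ (a ⊔ b) + (a ⊔ b) /2⌉ ≡⟨ n≡⌈n+n/2⌉ (a ⊔ b) ⟨
  a ⊔ b                 ∎
  where open ≤-Reasoning

⌊/2⌋-split-⊔ : ∀ {D} a b → a ≡ ⌊ D /2⌋ → a + b ≡ D → a ⊔ b ≤ ⌈ D /2⌉
⌊/2⌋-split-⊔ {D} a b refl a+b≡D = ⊔-lub (⌊n/2⌋≤⌈n/2⌉ D)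
  (≤-reflexive (+-cancelˡ-≡ a b ⌈ D /2⌉ (trans a+b≡D (sym (⌊n/2⌋+⌈n/2⌉≡n D)))))

2*⌈n/2⌉≤1+n : ∀ n → 2 * ⌈ n /2⌉ ≤ suc n
2*⌈n/2⌉≤1+n n = begin
  ⌈ n /2⌉ + (⌈ n /2⌉ + 0)   ≡⟨ cong (⌈ n /2⌉ +_) (+-identityʳ _) ⟩
  ⌊ suc n /2⌋ + ⌊ suc n /2⌋ ≤⟨ +-monoʳ-≤ ⌊ suc n /2⌋ (⌊n/2⌋≤⌈n/2⌉ (suc n)) ⟩
  ⌊ suc n /2⌋ + ⌈ suc n /2⌉ ≡⟨ ⌊n/2⌋+⌈n/2⌉≡n (suc n) ⟩
  suc n                     ∎
  where open ≤-Reasoning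

largest≤median+t⇒≤⊔+t : ∀ a b c t →
  a ⊔ b ⊔ c ≤ (a ⊓ b) ⊔ (b ⊓ c) ⊔ (a ⊓ c) + t → a ≤ (b ⊔ c) + t
largest≤median+t⇒≤⊔+t a b c t hyp = begin
  a                                ≤⟨ ≤-trans (m≤m⊔n a b) (m≤m⊔n (a ⊔ b) c) ⟩
  a ⊔ b ⊔ c                        ≤⟨ hyp ⟩
  (a ⊓ b) ⊔ (b ⊓ c) ⊔ (a ⊓ c) + t ≤⟨ +-monoˡ-≤ t median≤b⊔c ⟩
  (b ⊔ c) + t                      ∎
  where
  open ≤-Reasoning
  median≤b⊔c : (a ⊓ b) ⊔ (b ⊓ c) ⊔ (a ⊓ c) ≤ b ⊔ c
  median≤b⊔c = ⊔-lub (⊔-lub (≤-trans (m⊓n≤n a b) (m≤m⊔n b c)) (≤-trans (m⊓n≤m b c) (m≤m⊔n b c)))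
                     (≤-trans (m⊓n≤n a c) (m≤n⊔m b c))

module Eccentricity {n : ℕ} (d : Fin (suc n) → Fin (suc n) → ℕ) where

  d≤ecc : ∀ c u → d c u ≤ ecc d c
  d≤ecc c = ≤-max-tabulate (d c)

  ecc-lub : ∀ {c b} → (∀ u → d c u ≤ b) → ecc d c ≤ b
  ecc-lub {c} = max-tabulate-lub (d c)

  rad≤ecc : ∀ c → rad d ≤ ecc d c
  rad≤ecc = min-tabulate-≤ (ecc d)

  rad-glb : ∀ {b} → (∀ c → b ≤ ecc d c) → b ≤ rad d
  rad-glb = min-tabulate-glb (ecc d)

  ecc≤diam : ∀ c → ecc d c ≤ diam d
  ecc≤diam = ≤-max-tabulate (ecc d)

module ShortestPathDistance {n : ℕ} {G : Graph n} {d : Fin (suc n) → Fin (suc n) → ℕ}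
                            (sp : IsShortestPathDistance G d) where

  open Walks G
  open Eccentricity d

  geodesic : ∀ u v → Walk G u v (d u v)
  geodesic u v = proj₁ (sp u v)

  d-minimal : ∀ {u v k} → Walk G u v k → d u v ≤ k
  d-minimal {u} {v} = proj₂ (sp u v) _

  d-sym : ∀ u v → d u v ≡ d v u
  d-sym u v = ≤-antisym (d-minimal (reverse (geodesic v u))) (d-minimal (reverse (geodesic u v)))

  d-triangle : ∀ u v w → d u w ≤ d u v + d v w
  d-triangle u v w = d-minimal (geodesic u v ++ʷ geodesic v w)

  ⊔≤ecc : ∀ u v c → d u c ⊔ d v c ≤ ecc d c
  ⊔≤ecc u v c = ⊔-lub (≤-trans (≤-reflexive (d-sym u c)) (d≤ecc c u))
                      (≤-trans (≤-reflexive (d-sym v c)) (d≤ecc c v))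

  ⌈d/2⌉≤⊔ : ∀ u v c → ⌈ d u v /2⌉ ≤ d u c ⊔ d v c
  ⌈d/2⌉≤⊔ u v c = ⌈/2⌉≤⊔ (d u c) (d v c)
    (≤-trans (d-triangle u c v) (+-monoʳ-≤ (d u c) (≤-reflexive (d-sym c v))))

  ⌈d/2⌉≤rad : ∀ u v → ⌈ d u v /2⌉ ≤ rad d
  ⌈d/2⌉≤rad u v = rad-glb λ c → ≤-trans (⌈d/2⌉≤⊔ u v c) (⊔≤ecc u v c)

  inSlice⇒⊔≤⌈d/2⌉ : ∀ {u v c} → InSlice d ⌊ d u v /2⌋ u v c → d u c ⊔ d v c ≤ ⌈ d u v /2⌉
  inSlice⇒⊔≤⌈d/2⌉ {u} {v} {c} (c∈I , dcu≡k) = begin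
    d u c ⊔ d v c ≡⟨ cong (d u c ⊔_) (d-sym v c) ⟩
    d u c ⊔ d c v ≤⟨ ⌊/2⌋-split-⊔ (d u c) (d c v) (trans (d-sym u c) dcu≡k) c∈I ⟩
    ⌈ d u v /2⌉   ∎
    where open ≤-Reasoning

  slice-nonempty : ∀ {u v} k → k ≤ d u v → ∃ λ c → InSlice d k u v c
  slice-nonempty {u} {v} k k≤d with splitAt k (subst (Walk G u v) (sym (m+[n∸m]≡n k≤d)) (geodesic u v))
  ... | c , p₁ , p₂ = c , c∈I , trans (d-sym c u) duc≡k
    where
    duc≤k : d u c ≤ k
    duc≤k = d-minimal p₁
    dcv≤rest : d c v ≤ d u v ∸ k
    dcv≤rest = d-minimal p₂
    d≤duc+dcv : k + (d u v ∸ k) ≤ d u c + d c v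
    d≤duc+dcv = subst (_≤ d u c + d c v) (sym (m+[n∸m]≡n k≤d)) (d-triangle u c v)
    duc≡k : d u c ≡ k
    duc≡k = ≤-antisym duc≤k
      (+-cancelʳ-≤ _ k (d u c) (≤-trans d≤duc+dcv (+-monoʳ-≤ (d u c) dcv≤rest)))
    dcv≡rest : d c v ≡ d u v ∸ k
    dcv≡rest = ≤-antisym dcv≤rest
      (+-cancelˡ-≤ k _ (d c v) (≤-trans d≤duc+dcv (+-monoˡ-≤ (d c v) duc≤k)))
    c∈I : InInterval d u v c
    c∈I = trans (cong₂ _+_ duc≡k dcv≡rest) (m+[n∸m]≡n k≤d)

module MutuallyDistantPair
  {n : ℕ} {G : Graph n} {d : Fin (suc n) → Fin (suc n) → ℕ}
  (sp : IsShortestPathDistance G d) {t : ℕ} (hyp : HyperbolicWith2δ d t)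
  {x y : Fin (suc n)} (xy-distant : MutuallyDistant d x y) where

  open Eccentricity d
  open ShortestPathDistance sp

  D : ℕ
  D = d x y

  d-y≤D : ∀ v → d v y ≤ D
  d-y≤D v = ≤-trans (≤-reflexive (d-sym v y))
    (≤-trans (d≤ecc y v) (≤-reflexive (sym (proj₁ xy-distant))))

  d-x≤D : ∀ v → d v x ≤ D
  d-x≤D v = ≤-trans (≤-reflexive (d-sym v x))
    (≤-trans (d≤ecc x v) (≤-reflexive (trans (sym (proj₂ xy-distant)) (d-sym y x))))

  ecc≤⊔+t : ∀ c → ecc d c ≤ (d x c ⊔ d y c) + t
  ecc≤⊔+t c = ecc-lub λ v → +-cancelʳ-≤ D (d c v) (M + t) (begin
    d c v + D                               ≤⟨ largest≤median+t⇒≤⊔+t _ _ _ t (hyp c v x y) ⟩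
    (d c x + d v y) ⊔ (d c y + d v x) + t   ≤⟨ +-monoˡ-≤ t (⊔-lub (+-mono-≤ dcx≤M (d-y≤D v))
                                                                   (+-mono-≤ dcy≤M (d-x≤D v))) ⟩
    M + D + t                               ≡⟨ +-assoc M D t ⟩
    M + (D + t)                             ≡⟨ cong (M +_) (+-comm D t) ⟩
    M + (t + D)                             ≡⟨ +-assoc M t D ⟨
    M + t + D                               ∎)
    where
    open ≤-Reasoning
    M : ℕ
    M = d x c ⊔ d y c
    dcx≤M : d c x ≤ M
    dcx≤M = ≤-trans (≤-reflexive (d-sym c x)) (m≤m⊔n _ _)
    dcy≤M : d c y ≤ M
    dcy≤M = ≤-trans (≤-reflexive (d-sym c y)) (m≤n⊔m _ _)

  central-ecc≤⌈D/2⌉+t : ∀ c → InSlice d ⌊ D /2⌋ x y c ⊎ InSlice d ⌊ D /2⌋ y x c →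
                        ecc d c ≤ ⌈ D /2⌉ + t
  central-ecc≤⌈D/2⌉+t c c-central = ≤-trans (ecc≤⊔+t c) (+-monoˡ-≤ t (⊔≤⌈D/2⌉ c-central))
    where
    ⊔≤⌈D/2⌉ : InSlice d ⌊ D /2⌋ x y c ⊎ InSlice d ⌊ D /2⌋ y x c → d x c ⊔ d y c ≤ ⌈ D /2⌉
    ⊔≤⌈D/2⌉ (inj₁ c∈S) = inSlice⇒⊔≤⌈d/2⌉ c∈S
    ⊔≤⌈D/2⌉ (inj₂ c∈S) rewrite ⊔-comm (d x c) (d y c) | d-sym x y = inSlice⇒⊔≤⌈d/2⌉ c∈S

  2*rad≤D+2t+1 : 2 * rad d ≤ D + 2 * t + 1
  2*rad≤D+2t+1 with slice-nonempty {x} {y} ⌊ D /2⌋ (⌊n/2⌋≤n D)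
  ... | c , c∈S = begin
    2 * rad d               ≤⟨ *-monoʳ-≤ 2 (≤-trans (rad≤ecc c) (central-ecc≤⌈D/2⌉+t c (inj₁ c∈S))) ⟩
    2 * (⌈ D /2⌉ + t)       ≡⟨ *-distribˡ-+ 2 ⌈ D /2⌉ t ⟩
    2 * ⌈ D /2⌉ + 2 * t     ≤⟨ +-monoˡ-≤ (2 * t) (2*⌈n/2⌉≤1+n D) ⟩
    suc D + 2 * t           ≡⟨ cong suc (+-comm D (2 * t)) ⟩
    suc (2 * t + D)         ≡⟨ +-comm 1 (2 * t + D) ⟩
    2 * t + D + 1           ≡⟨ cong (_+ 1) (+-comm (2 * t) D) ⟩
    D + 2 * t + 1           ∎
    where open ≤-Reasoning

theorem29 : (n : ℕ) (G : Graph n) (d : Fin (suc n) → Fin (suc n) → ℕ) →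
    Connected G → IsShortestPathDistance G d →
    (t : ℕ) → HyperbolicWith2δ d t →
    (x y : Fin (suc n)) → MutuallyDistant d x y →
    ((c : Fin (suc n)) →
        (d x c ⊔ d y c ≤ ecc d c) × (ecc d c ≤ (d x c ⊔ d y c) + t))
    × ((c* : Fin (suc n)) →
        (InSlice d ⌊ d x y /2⌋ x y c* ⊎ InSlice d ⌊ d x y /2⌋ y x c*) →
        (ecc d c* ≤ ⌈ d x y /2⌉ + t) × (⌈ d x y /2⌉ + t ≤ rad d + t))
    × ((d x y ≤ diam d) × (2 * rad d ≤ d x y + 2 * t + 1))
-- Connectivity is implied by IsShortestPathDistance, which provides a walk between any two vertices.
theorem29 n G d _ sp t hyp x y xy-distant =
    (λ c → ⊔≤ecc x y c , ecc≤⊔+t c)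
  , (λ c c-central → central-ecc≤⌈D/2⌉+t c c-central , +-monoˡ-≤ t (⌈d/2⌉≤rad x y))
  , ≤-trans (≤-reflexive (proj₁ xy-distant)) (ecc≤diam y)
  , 2*rad≤D+2t+1
  where
  open Eccentricity d
  open ShortestPathDistance sp
  open MutuallyDistantPair sp hyp xy-distant
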